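{- Let $n\ge 3$ be an integer with $n\neq 4$, and let $C_n$ be the cycle graph of order $n$. Then every automorphism of $F_2(C_n)$ is induced by an automorphism of $C_n$, i.e. $\mathrm{Aut}(F_2(C_n))=\mathrm{Aut}(C_n)$ (the dihedral group of order $2n$).
   Context: For a graph $\Gamma$, the $2$-token graph $F_2(\Gamma)$ has as vertices all $2$-element subsets of $V(\Gamma)$, two being adjacent iff their symmetric difference is an edge of $\Gamma$. An automorphism $\theta$ of $\Gamma$ induces the automorphism $\{a,b\}\mapsto\{\theta(a),\theta(b)\}$ of $F_2(\Gamma)$; $\mathrm{Aut}(F_2(\Gamma))=\mathrm{Aut}(\Gamma)$ means every automorphism of $F_2(\Gamma)$ is of this form. -}

module Defs where

open import Data.Nat using (ℕ; suc)
open import Data.Nat.DivMod using (_mod_)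
open import Data.Fin using (Fin; toℕ; _<_)
open import Data.Product using (Σ; ∃; _×_; _,_; proj₁; proj₂)
open import Data.Sum using (_⊎_)
open import Relation.Nullary using (¬_)
open import Relation.Binary.PropositionalEquality using (_≡_)
open import Function.Bundles using (_⇔_)

Graph : ℕ → Set₁
Graph n = Fin n → Fin n → Set

succMod : ∀ {n} → Fin n → Fin n
succMod {suc n} i = suc (toℕ i) mod (suc n)

Cycle : (n : ℕ) → Graph n
Cycle n i j = (j ≡ succMod i) ⊎ (i ≡ succMod j)

record Automorphism {V : Set} (Adj : V → V → Set) : Set where
  field
    f     : V → V
    f⁻¹   : V → V
    left  : ∀ x → f⁻¹ (f x) ≡ x
    right : ∀ x → f (f⁻¹ x) ≡ x
    adj   : ∀ x y → Adj x y ⇔ Adj (f x) (f y)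

-- 2-element subsets of Fin n, represented canonically as {a,b} with a < b.
Pair : ℕ → Set
Pair n = Σ (Fin n × Fin n) (λ p → proj₁ p < proj₂ p)

_∈ₚ_ : ∀ {n} → Fin n → Pair n → Set
x ∈ₚ ((a , b) , _) = (x ≡ a) ⊎ (x ≡ b)

_∈Δ_,_ : ∀ {n} → Fin n → Pair n → Pair n → Set
z ∈Δ S , T = ((z ∈ₚ S) × ¬ (z ∈ₚ T)) ⊎ ((z ∈ₚ T) × ¬ (z ∈ₚ S))

Token2Adj : ∀ {n} → Graph n → Pair n → Pair n → Set
Token2Adj Γ S T =
  Σ _ λ x → Σ _ λ y → Γ x y × (∀ z → (z ∈Δ S , T) ⇔ ((z ≡ x) ⊎ (z ≡ y)))

InducedBy : ∀ {n} → (Fin n → Fin n) → (Pair n → Pair n) → Set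
InducedBy θ φ = ∀ S z → (z ∈ₚ φ S) ⇔ (Σ _ λ x → (x ∈ₚ S) × (z ≡ θ x))

-- For n ≥ 3 and n ≠ 4 the cycle Cₙ contains no 4-cycle. In the 2-token graph of a
-- square-free graph, two pairs that are edges and have a common neighbour intersect,
-- and pairs {a,b}, {c,d} with a ~ c and b ~ d have no common neighbours besides
-- {a,d} and {b,c}.
-- In F₂(Cₙ) an edge {a, a+1} has only the neighbours {a, a+2} and {a+1, a−1}, while
-- every other pair has at least three, so an automorphism φ of F₂(Cₙ) maps edges to
-- edges. The edges {v−1, v} and {v, v+1} are both adjacent to {v−1, v+1}, hence their
-- images share a vertex θ v; θ is an automorphism of Cₙ, with inverse obtained from
-- φ⁻¹ in the same way. Finally φ{i, i+k} = {θ i, θ(i+k)} by induction on k: for k = 2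
-- it is the only common neighbour of φ{i, i+1} and φ{i+1, i+2}, and for k > 2 it is
-- the common neighbour of φ{i, i+k−1} and φ{i+1, i+k} other than φ{i+1, i+k−1}.

module Submission where

open import Data.Empty using (⊥; ⊥-elim)
open import Data.Fin using (Fin; toℕ) renaming (_≟_ to _≟ᶠ_)
open import Data.Fin.Properties using (toℕ-injective; toℕ-fromℕ<; toℕ<n)
open import Data.Nat using (ℕ; zero; suc; _+_; _∸_; _≤_; _<_; _<?_; _≟_; _%_; z≤n; s≤s)
open import Data.Nat.DivMod using (_mod_; m%n<n; m%n%n≡m%n; %-distribˡ-+; [m+n]%n≡m%n; m<n⇒m%n≡m)
open import Data.Nat.Properties
open import Data.Product using (Σ; _×_; _,_; proj₁; proj₂; uncurry)
open import Data.Sum using (_⊎_; inj₁; inj₂; swap; [_,_]′)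
open import Function using (_∘_)
open import Function.Bundles using (_⇔_; mk⇔; Equivalence)
open import Relation.Binary.Definitions using (Symmetric; Irreflexive; tri<; tri≈; tri>)
open import Relation.Binary.PropositionalEquality
open import Relation.Nullary using (¬_; Dec; yes; no; contradiction)

open import Defs

private
  variable
    A : Set
    n : ℕ
    a b c d u v x y z : A

resolveʳ : x ≡ a ⊎ x ≡ b → x ≢ a → x ≡ b
resolveʳ (inj₁ x≡a) x≢a = contradiction x≡a x≢a
resolveʳ (inj₂ x≡b) _   = x≡b

relabel : c ≡ a ⊎ c ≡ b → u ≡ a ⊎ u ≡ b → c ≢ u → z ≡ a ⊎ z ≡ b → z ≡ c ⊎ z ≡ u
relabel (inj₁ refl) (inj₁ refl) c≢u _           = contradiction refl c≢u
relabel (inj₁ refl) (inj₂ refl) _   (inj₁ refl) = inj₁ refl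
relabel (inj₁ refl) (inj₂ refl) _   (inj₂ refl) = inj₂ refl
relabel (inj₂ refl) (inj₁ refl) _   (inj₁ refl) = inj₂ refl
relabel (inj₂ refl) (inj₁ refl) _   (inj₂ refl) = inj₁ refl
relabel (inj₂ refl) (inj₂ refl) c≢u _           = contradiction refl c≢u

no-three-in-two : x ≡ a ⊎ x ≡ b → y ≡ a ⊎ y ≡ b → z ≡ a ⊎ z ≡ b →
                  x ≢ y → x ≢ z → y ≢ z → ⊥
no-three-in-two (inj₁ refl) (inj₁ refl) _           x≢y _   _   = x≢y refl
no-three-in-two (inj₂ refl) (inj₂ refl) _           x≢y _   _   = x≢y refl
no-three-in-two (inj₁ refl) (inj₂ refl) (inj₁ refl) _   x≢z _   = x≢z refl
no-three-in-two (inj₁ refl) (inj₂ refl) (inj₂ refl) _   _   y≢z = y≢z refl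
no-three-in-two (inj₂ refl) (inj₁ refl) (inj₁ refl) _   _   y≢z = y≢z refl
no-three-in-two (inj₂ refl) (inj₁ refl) (inj₂ refl) _   x≢z _   = x≢z refl

-- Two-element subsets

record IsPair {n : ℕ} (S : Pair n) (c u : Fin n) : Set where
  constructor isPair
  field
    ∈ˡ       : c ∈ₚ S
    ∈ʳ       : u ∈ₚ S
    distinct : c ≢ u

open IsPair public

private
  variable
    S T P Q U : Pair n

isPair-∈ : IsPair S c u → z ∈ₚ S → z ≡ c ⊎ z ≡ u
isPair-∈ {S = (_ , _) , _} (isPair c∈S u∈S c≢u) = relabel c∈S u∈S c≢u

isPair-swap : IsPair S c u → IsPair S u c
isPair-swap (isPair c∈S u∈S c≢u) = isPair u∈S c∈S (λ u≡c → c≢u (sym u≡c))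

toℕ<⇒≢ : {a b : Fin n} → toℕ a < toℕ b → a ≢ b
toℕ<⇒≢ a<b refl = <-irrefl refl a<b

isPair-ends : (S : Pair n) → IsPair S (proj₁ (proj₁ S)) (proj₂ (proj₁ S))
isPair-ends (_ , a<b) = isPair (inj₁ refl) (inj₂ refl) (toℕ<⇒≢ a<b)

isPair-⊆ : IsPair S c u → IsPair T c u → z ∈ₚ S → z ∈ₚ T
isPair-⊆ S≐cu T≐cu z∈S with isPair-∈ S≐cu z∈S
... | inj₁ refl = ∈ˡ T≐cu
... | inj₂ refl = ∈ʳ T≐cu

isPair-unique : IsPair S c u → IsPair T c u → S ≡ T
isPair-unique {S = (a , b) , a<b} {T = (a′ , b′) , a′<b′} S≐ T≐ =
  same (isPair-⊆ S≐ T≐ (inj₁ refl)) (isPair-⊆ S≐ T≐ (inj₂ refl)) (isPair-⊆ T≐ S≐ (inj₁ refl))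
  where
    same : a ∈ₚ ((a′ , b′) , a′<b′) → b ∈ₚ ((a′ , b′) , a′<b′) → a′ ∈ₚ ((a , b) , a<b) →
           ((a , b) , a<b) ≡ ((a′ , b′) , a′<b′)
    same (inj₁ refl) (inj₂ refl) _           = cong (λ lt → (a , b) , lt) (<-irrelevant a<b a′<b′)
    same (inj₁ refl) (inj₁ refl) _           = contradiction a<b (<-irrefl refl)
    same (inj₂ refl) _           (inj₁ refl) = contradiction a′<b′ (<-irrefl refl)
    same (inj₂ refl) _           (inj₂ refl) = contradiction a′<b′ (<-asym a<b)

pairOf : (c u : Fin n) → c ≢ u → Σ (Pair n) λ S → IsPair S c u
pairOf c u c≢u with <-cmp (toℕ c) (toℕ u)
... | tri< c<u _ _ = ((c , u) , c<u) , isPair (inj₁ refl) (inj₂ refl) c≢u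
... | tri≈ _ c≡u _ = contradiction (toℕ-injective c≡u) c≢u
... | tri> _ _ u<c = ((u , c) , u<c) , isPair (inj₂ refl) (inj₁ refl) c≢u

partner : z ∈ₚ S → Σ (Fin _) (IsPair S z)
partner {S = (a , b) , a<b} (inj₁ refl) = b , isPair-ends (_ , a<b)
partner {S = (a , b) , a<b} (inj₂ refl) = a , isPair-swap (isPair-ends (_ , a<b))

_∈ₚ?_ : (z : Fin n) (S : Pair n) → Dec (z ∈ₚ S)
z ∈ₚ? ((a , b) , _) with z ≟ᶠ a | z ≟ᶠ b
... | yes z≡a | _       = yes (inj₁ z≡a)
... | no _    | yes z≡b = yes (inj₂ z≡b)
... | no z≢a  | no z≢b  = no λ { (inj₁ z≡a) → z≢a z≡a ; (inj₂ z≡b) → z≢b z≡b }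

isPair⇒inducedBy : {θ : Fin n → Fin n} {φ : Pair n → Pair n} →
                   (∀ S → IsPair (φ S) (θ (proj₁ (proj₁ S))) (θ (proj₂ (proj₁ S)))) → InducedBy θ φ
isPair⇒inducedBy {θ = θ} {φ} φS≐ S@((a , b) , _) z = mk⇔ to from
  where
    to : z ∈ₚ φ S → Σ _ λ x → x ∈ₚ S × z ≡ θ x
    to z∈ with isPair-∈ (φS≐ S) z∈
    ... | inj₁ z≡θa = a , inj₁ refl , z≡θa
    ... | inj₂ z≡θb = b , inj₂ refl , z≡θb

    from : (Σ _ λ x → x ∈ₚ S × z ≡ θ x) → z ∈ₚ φ S
    from (_ , inj₁ refl , refl) = ∈ˡ (φS≐ S)
    from (_ , inj₂ refl , refl) = ∈ʳ (φS≐ S)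

Disjoint : Pair n → Pair n → Set
Disjoint S T = ∀ z → z ∈ₚ S → z ∈ₚ T → ⊥

common : Pair n → Pair n → Fin n
common ((a , b) , _) T with a ∈ₚ? T
... | yes _ = a
... | no _  = b

common-∈ : ¬ Disjoint S T → common S T ∈ₚ S × common S T ∈ₚ T
common-∈ {S = (a , b) , _} {T} meet with a ∈ₚ? T
... | yes a∈T = inj₁ refl , a∈T
... | no a∉T with b ∈ₚ? T
...   | yes b∈T = inj₂ refl , b∈T
...   | no b∉T  = ⊥-elim (meet λ { _ (inj₁ refl) a∈T → a∉T a∈T ; _ (inj₂ refl) b∈T → b∉T b∈T })

-- Adjacency in the 2-token graph

record TokenStep {n : ℕ} (Γ : Graph n) (S T : Pair n) : Set where
  constructor tokenStep
  field
    kept src dst : Fin n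
    before       : IsPair S kept src
    after        : IsPair T kept dst
    move         : Γ src dst

SymDiff : Pair n → Pair n → Fin n → Fin n → Set
SymDiff S T x y = ∀ z → (z ∈Δ S , T) ⇔ ((z ≡ x) ⊎ (z ≡ y))

IsEdgeOf : Graph n → Pair n → Set
IsEdgeOf Γ P = ∀ {x y} → IsPair P x y → Γ x y

module _ {Γ : Graph n} where

  adj-relabel : Symmetric Γ → Γ a b → x ≡ a ⊎ x ≡ b → y ≡ a ⊎ y ≡ b → x ≢ y → Γ x y
  adj-relabel _     a~b (inj₁ refl) (inj₁ refl) x≢y = contradiction refl x≢y
  adj-relabel _     a~b (inj₁ refl) (inj₂ refl) _   = a~b
  adj-relabel Γ-sym a~b (inj₂ refl) (inj₁ refl) _   = Γ-sym a~b
  adj-relabel _     a~b (inj₂ refl) (inj₂ refl) x≢y = contradiction refl x≢y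

  isEdgeOf : Symmetric Γ → Γ a b → IsPair P a b → IsEdgeOf Γ P
  isEdgeOf Γ-sym a~b P≐ab P≐xy =
    adj-relabel Γ-sym a~b (isPair-∈ P≐ab (∈ˡ P≐xy)) (isPair-∈ P≐ab (∈ʳ P≐xy)) (distinct P≐xy)

  tokenStep⇒Token2Adj : Irreflexive _≡_ Γ → TokenStep Γ S T → Token2Adj Γ S T
  tokenStep⇒Token2Adj {S = S} {T = T} irr (tokenStep c u v S≐ T≐ u~v) =
    u , v , u~v , λ z → mk⇔ to from
    where
      u∉T : ¬ u ∈ₚ T
      u∉T u∈T with isPair-∈ T≐ u∈T
      ... | inj₁ u≡c = distinct S≐ (sym u≡c)
      ... | inj₂ u≡v = irr u≡v u~v

      v∉S : ¬ v ∈ₚ S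
      v∉S v∈S with isPair-∈ S≐ v∈S
      ... | inj₁ v≡c = distinct T≐ (sym v≡c)
      ... | inj₂ v≡u = irr (sym v≡u) u~v

      to : ∀ {z} → z ∈Δ S , T → z ≡ u ⊎ z ≡ v
      to (inj₁ (z∈S , z∉T)) = inj₁ (resolveʳ (isPair-∈ S≐ z∈S) λ { refl → z∉T (∈ˡ T≐) })
      to (inj₂ (z∈T , z∉S)) = inj₂ (resolveʳ (isPair-∈ T≐ z∈T) λ { refl → z∉S (∈ˡ S≐) })

      from : ∀ {z} → z ≡ u ⊎ z ≡ v → z ∈Δ S , T
      from (inj₁ refl) = inj₁ (∈ʳ S≐ , u∉T)
      from (inj₂ refl) = inj₂ (∈ʳ T≐ , v∉S)

  tokenStep-keeping : Symmetric Γ → Γ x y → SymDiff S T x y →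
                      IsPair S c u → c ∈ₚ T → ¬ u ∈ₚ T → TokenStep Γ S T
  tokenStep-keeping {x = x} {y = y} {S = S} {T = T} {c = c} {u = u} Γ-sym x~y Δ≐ S≐cu c∈T u∉T =
    tokenStep c u t S≐cu T≐ct (adj-relabel Γ-sym x~y (inΔ (inj₁ (∈ʳ S≐cu , u∉T))) (inΔ (inj₂ (∈ʳ T≐ct , t∉S))) u≢t)
    where
      t = proj₁ (partner c∈T)
      T≐ct = proj₂ (partner c∈T)

      inΔ : ∀ {z} → z ∈Δ S , T → z ≡ x ⊎ z ≡ y
      inΔ {z} = Equivalence.to (Δ≐ z)

      t∉S : ¬ t ∈ₚ S
      t∉S t∈S with isPair-∈ S≐cu t∈S
      ... | inj₁ t≡c  = distinct T≐ct (sym t≡c)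
      ... | inj₂ t≡u  = u∉T (subst (_∈ₚ T) t≡u (∈ʳ T≐ct))

      u≢t : u ≢ t
      u≢t u≡t = t∉S (subst (_∈ₚ S) u≡t (∈ʳ S≐cu))

  Token2Adj⇒tokenStep : Symmetric Γ → Token2Adj Γ S T → TokenStep Γ S T
  Token2Adj⇒tokenStep {S = S@((a , b) , a<b)} {T = T@((a′ , _) , _)} Γ-sym (x , y , x~y , Δ≐)
    with a ∈ₚ? T | b ∈ₚ? T
  ... | yes a∈T | yes b∈T = ⊥-elim (S≢T (Equivalence.from (Δ≐ x) (inj₁ refl)))
    where
      T≐ab : IsPair T a b
      T≐ab = isPair a∈T b∈T (toℕ<⇒≢ a<b)

      S≢T : ¬ x ∈Δ S , T
      S≢T (inj₁ (x∈S , x∉T)) = x∉T (isPair-⊆ (isPair-ends S) T≐ab x∈S)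
      S≢T (inj₂ (x∈T , x∉S)) = x∉S (isPair-⊆ T≐ab (isPair-ends S) x∈T)
  ... | yes a∈T | no b∉T  = tokenStep-keeping Γ-sym x~y Δ≐ (isPair-ends S) a∈T b∉T
  ... | no a∉T  | yes b∈T = tokenStep-keeping Γ-sym x~y Δ≐ (isPair-swap (isPair-ends S)) b∈T a∉T
  ... | no a∉T  | no b∉T  = ⊥-elim (a′∉S (relabel (inΔ a∈Δ) (inΔ b∈Δ) (toℕ<⇒≢ a<b) (inΔ a′∈Δ)))
    where
      inΔ : ∀ {z} → z ∈Δ S , T → z ≡ x ⊎ z ≡ y
      inΔ {z} = Equivalence.to (Δ≐ z)

      a′∉S : ¬ a′ ∈ₚ S
      a′∉S (inj₁ refl) = a∉T (inj₁ refl)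
      a′∉S (inj₂ refl) = b∉T (inj₁ refl)

      a∈Δ : a ∈Δ S , T
      a∈Δ = inj₁ (inj₁ refl , a∉T)
      b∈Δ : b ∈Δ S , T
      b∈Δ = inj₁ (inj₂ refl , b∉T)
      a′∈Δ : a′ ∈Δ S , T
      a′∈Δ = inj₂ (inj₁ refl , a′∉S)

-- Token graphs of square-free graphs

SquareFree : Graph n → Set
SquareFree Γ = ∀ {a b c d} → Γ a b → Γ b c → Γ c d → Γ d a → a ≢ c → b ≢ d → ⊥

module SquareFreeTokens {n : ℕ} {Γ : Graph n} (Γ-sym : Symmetric Γ)
  (Γ-irrefl : Irreflexive _≡_ Γ) (Γ-squareFree : SquareFree Γ) where

  tokenStep-irreflexive : TokenStep Γ T P → IsPair T x y → IsPair P x y → ⊥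
  tokenStep-irreflexive (tokenStep k s t T≐ks P≐kt s~t) T≐xy P≐xy
    with isPair-∈ T≐ks (isPair-⊆ P≐xy T≐xy (∈ʳ P≐kt))
  ... | inj₁ t≡k = distinct P≐kt (sym t≡k)
  ... | inj₂ t≡s = Γ-irrefl (sym t≡s) s~t

  tokenStep-moves : TokenStep Γ T P → IsPair T c u → IsPair P c v → Γ u v
  tokenStep-moves {c = c} st@(tokenStep k s t T≐ks P≐kt s~t) T≐cu P≐cv with isPair-∈ T≐cu (∈ˡ T≐ks)
  ... | inj₁ refl = subst₂ Γ (resolveʳ (isPair-∈ T≐cu (∈ʳ T≐ks)) (distinct T≐ks ∘ sym))
                             (resolveʳ (isPair-∈ P≐cv (∈ʳ P≐kt)) (distinct P≐kt ∘ sym)) s~t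
  ... | inj₂ refl = ⊥-elim (tokenStep-irreflexive st T≐cu (isPair (∈ˡ P≐cv) (∈ˡ P≐kt) (distinct T≐cu)))

  edgePairs-meet : IsEdgeOf Γ P → IsEdgeOf Γ Q → TokenStep Γ T P → TokenStep Γ T Q → ¬ Disjoint P Q
  edgePairs-meet {P = P} {Q = Q} P-edge Q-edge
    st₁@(tokenStep k₁ _ v₁ T≐₁ P≐₁ _) st₂@(tokenStep k₂ _ v₂ T≐₂ Q≐₂ _) disjoint =
    Γ-squareFree (P-edge P≐₁) (Γ-sym (tokenStep-moves st₁ T≐k₁k₂ P≐₁))
                 (Q-edge Q≐₂) (Γ-sym (tokenStep-moves st₂ (isPair-swap T≐k₁k₂) Q≐₂))
                 k₁≢k₂ (λ v₁≡v₂ → disjoint v₁ (∈ʳ P≐₁) (subst (_∈ₚ Q) (sym v₁≡v₂) (∈ʳ Q≐₂)))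
    where
      k₁≢k₂ : k₁ ≢ k₂
      k₁≢k₂ k₁≡k₂ = disjoint k₁ (∈ˡ P≐₁) (subst (_∈ₚ Q) (sym k₁≡k₂) (∈ˡ Q≐₂))
      T≐k₁k₂ = isPair (∈ˡ T≐₁) (∈ˡ T≐₂) k₁≢k₂

  commonNeighbour-path : Γ a b → Γ b c → a ≢ c → IsPair P a b → IsPair U b c →
                         TokenStep Γ T P → TokenStep Γ T U → IsPair T a c
  commonNeighbour-path a~b b~c a≢c P≐ab U≐bc
    st₁@(tokenStep k₁ _ _ T≐₁ P≐₁ _) st₂@(tokenStep k₂ _ _ T≐₂ U≐₂ _)
    with isPair-∈ P≐ab (∈ˡ P≐₁) | isPair-∈ U≐bc (∈ˡ U≐₂)
  ... | inj₁ refl | inj₂ refl = isPair (∈ˡ T≐₁) (∈ˡ T≐₂) a≢c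
  ... | inj₁ refl | inj₁ refl =
    ⊥-elim (tokenStep-irreflexive st₁ (isPair (∈ˡ T≐₁) (∈ˡ T≐₂) (distinct P≐ab)) P≐ab)
  ... | inj₂ refl | inj₂ refl =
    ⊥-elim (tokenStep-irreflexive st₂ (isPair (∈ˡ T≐₁) (∈ˡ T≐₂) (distinct U≐bc)) U≐bc)
  ... | inj₂ refl | inj₁ refl =
    ⊥-elim (Γ-squareFree a~b b~c (Γ-sym (tokenStep-moves st₂ T≐₁ U≐bc))
                         (tokenStep-moves st₁ T≐₁ (isPair-swap P≐ab)) a≢c (distinct T≐₁))

  commonNeighbour-ladder : Γ a c → Γ b d → a ≢ d → b ≢ c → IsPair P a b → IsPair U c d →
                           TokenStep Γ T P → TokenStep Γ T U → ¬ IsPair T b c → IsPair T a d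
  commonNeighbour-ladder a~c b~d a≢d b≢c P≐ab U≐cd
    st₁@(tokenStep k₁ _ _ T≐₁ P≐₁ _) st₂@(tokenStep k₂ _ _ T≐₂ U≐₂ _) T≢bc
    with isPair-∈ P≐ab (∈ˡ P≐₁) | isPair-∈ U≐cd (∈ˡ U≐₂)
  ... | inj₁ refl | inj₂ refl = isPair (∈ˡ T≐₁) (∈ˡ T≐₂) a≢d
  ... | inj₂ refl | inj₁ refl = ⊥-elim (T≢bc (isPair (∈ˡ T≐₁) (∈ˡ T≐₂) b≢c))
  ... | inj₁ refl | inj₁ refl =
    ⊥-elim (Γ-squareFree a~c (tokenStep-moves st₁ T≐ac P≐ab) b~d
                         (Γ-sym (tokenStep-moves st₂ (isPair-swap T≐ac) U≐cd))
                         (distinct P≐ab) (distinct U≐cd))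
    where T≐ac = isPair (∈ˡ T≐₁) (∈ˡ T≐₂) (λ a≡c → Γ-irrefl a≡c a~c)
  ... | inj₂ refl | inj₂ refl =
    ⊥-elim (Γ-squareFree a~c (Γ-sym (tokenStep-moves st₂ (isPair-swap T≐bd) (isPair-swap U≐cd))) b~d
                         (tokenStep-moves st₁ T≐bd (isPair-swap P≐ab))
                         (distinct P≐ab) (distinct U≐cd))
    where T≐bd = isPair (∈ˡ T≐₁) (∈ˡ T≐₂) (λ b≡d → Γ-irrefl b≡d b~d)

-- Arithmetic modulo n

module _ {m : ℕ} where

  -- k is added on the left so that rot 1 is succMod by definition.
  rot : ℕ → Fin (suc m) → Fin (suc m)
  rot k x = (k + toℕ x) mod suc m

  predMod : Fin (suc m) → Fin (suc m)
  predMod = rot m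

  toℕ-rot : ∀ k (x : Fin (suc m)) → toℕ (rot k x) ≡ (k + toℕ x) % suc m
  toℕ-rot k x = toℕ-fromℕ< (m%n<n (k + toℕ x) (suc m))

  rot-rot : ∀ j k (x : Fin (suc m)) → rot j (rot k x) ≡ rot (j + k) x
  rot-rot j k x = toℕ-injective (begin
    toℕ (rot j (rot k x))             ≡⟨ toℕ-rot j (rot k x) ⟩
    (j + toℕ (rot k x)) % suc m       ≡⟨ cong (λ t → (j + t) % suc m) (toℕ-rot k x) ⟩
    (j + (k + toℕ x) % suc m) % suc m ≡⟨ %-distribˡ-+ j _ (suc m) ⟩
    (j % suc m + (k + toℕ x) % suc m % suc m) % suc m
      ≡⟨ cong (λ t → (j % suc m + t) % suc m) (m%n%n≡m%n (k + toℕ x) (suc m)) ⟩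
    (j % suc m + (k + toℕ x) % suc m) % suc m ≡⟨ %-distribˡ-+ j (k + toℕ x) (suc m) ⟨
    (j + (k + toℕ x)) % suc m         ≡⟨ cong (_% suc m) (+-assoc j k (toℕ x)) ⟨
    (j + k + toℕ x) % suc m           ≡⟨ toℕ-rot (j + k) x ⟨
    toℕ (rot (j + k) x)               ∎)
    where open ≡-Reasoning

  succMod-rot : ∀ k (x : Fin (suc m)) → succMod (rot k x) ≡ rot (suc k) x
  succMod-rot k x = rot-rot 1 k x

  rot-succMod : ∀ k (x : Fin (suc m)) → rot k (succMod x) ≡ rot (suc k) x
  rot-succMod k x = trans (rot-rot k 1 x) (cong (λ i → rot i x) (+-comm k 1))

  rot-full : (x : Fin (suc m)) → rot (suc m) x ≡ x
  rot-full x = toℕ-injective (begin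
    toℕ (rot (suc m) x)        ≡⟨ toℕ-rot (suc m) x ⟩
    (suc m + toℕ x) % suc m    ≡⟨ cong (_% suc m) (+-comm (suc m) (toℕ x)) ⟩
    (toℕ x + suc m) % suc m    ≡⟨ [m+n]%n≡m%n (toℕ x) (suc m) ⟩
    toℕ x % suc m              ≡⟨ m<n⇒m%n≡m (toℕ<n x) ⟩
    toℕ x                      ∎)
    where open ≡-Reasoning

  rot-between : {a b : Fin (suc m)} → toℕ a < toℕ b → rot (toℕ b ∸ toℕ a) a ≡ b
  rot-between {a} {b} a<b = toℕ-injective (begin
    toℕ (rot (toℕ b ∸ toℕ a) a)     ≡⟨ toℕ-rot (toℕ b ∸ toℕ a) a ⟩
    (toℕ b ∸ toℕ a + toℕ a) % suc m ≡⟨ cong (_% suc m) (m∸n+n≡m (<⇒≤ a<b)) ⟩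
    toℕ b % suc m                   ≡⟨ m<n⇒m%n≡m (toℕ<n b) ⟩
    toℕ b                           ∎)
    where open ≡-Reasoning

  rot-fixedPoint-free : ∀ {k} (x : Fin (suc m)) → 0 < k → k < suc m → rot k x ≢ x
  rot-fixedPoint-free {k} x 0<k k<n rot≡x with k + toℕ x <? suc m
  ... | yes k+x<n = <-irrefl (sym (+-cancelʳ-≡ (toℕ x) k 0 k+x≡x)) 0<k
    where
      k+x≡x : k + toℕ x ≡ toℕ x
      k+x≡x = trans (sym (m<n⇒m%n≡m k+x<n)) (trans (sym (toℕ-rot k x)) (cong toℕ rot≡x))
  ... | no k+x≮n = <-irrefl (+-cancelʳ-≡ (toℕ x) k (suc m) k+x≡n+x) k<n
    where
      n≤k+x : suc m ≤ k + toℕ x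
      n≤k+x = ≮⇒≥ k+x≮n
      r = k + toℕ x ∸ suc m
      r+n≡k+x : r + suc m ≡ k + toℕ x
      r+n≡k+x = m∸n+n≡m n≤k+x
      r<n : r < suc m
      r<n = +-cancelʳ-< (suc m) r (suc m)
              (subst (_< suc m + suc m) (sym r+n≡k+x) (+-mono-< k<n (toℕ<n x)))
      r≡x : r ≡ toℕ x
      r≡x = begin
        r                       ≡⟨ m<n⇒m%n≡m r<n ⟨
        r % suc m               ≡⟨ [m+n]%n≡m%n r (suc m) ⟨
        (r + suc m) % suc m     ≡⟨ cong (_% suc m) r+n≡k+x ⟩
        (k + toℕ x) % suc m     ≡⟨ toℕ-rot k x ⟨
        toℕ (rot k x)           ≡⟨ cong toℕ rot≡x ⟩
        toℕ x                   ∎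
        where open ≡-Reasoning
      k+x≡n+x : k + toℕ x ≡ suc m + toℕ x
      k+x≡n+x = trans (sym r+n≡k+x) (trans (cong (_+ suc m) r≡x) (+-comm (toℕ x) (suc m)))

  rot-injectiveʳ : ∀ {j k} (x : Fin (suc m)) → j < k → k < suc m → rot j x ≢ rot k x
  rot-injectiveʳ {j} {k} x j<k k<n rotj≡rotk =
    rot-fixedPoint-free (rot j x) (m<n⇒0<n∸m j<k) (≤-<-trans (m∸n≤m k j) k<n) (begin
      rot (k ∸ j) (rot j x) ≡⟨ rot-rot (k ∸ j) j x ⟩
      rot (k ∸ j + j) x     ≡⟨ cong (λ i → rot i x) (m∸n+n≡m (<⇒≤ j<k)) ⟩
      rot k x               ≡⟨ rotj≡rotk ⟨
      rot j x               ∎)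
    where open ≡-Reasoning

  predMod-succMod : (x : Fin (suc m)) → predMod (succMod x) ≡ x
  predMod-succMod x = trans (rot-rot m 1 x) (trans (cong (λ i → rot i x) (+-comm m 1)) (rot-full x))

  succMod-predMod : (x : Fin (suc m)) → succMod (predMod x) ≡ x
  succMod-predMod x = trans (rot-rot 1 m x) (rot-full x)

  succMod-injective : {x y : Fin (suc m)} → succMod x ≡ succMod y → x ≡ y
  succMod-injective {x} {y} sx≡sy =
    trans (sym (predMod-succMod x)) (trans (cong predMod sx≡sy) (predMod-succMod y))

  succMod-fixedPoint-free : 1 ≤ m → (x : Fin (suc m)) → succMod x ≢ x
  succMod-fixedPoint-free 1≤m x = rot-fixedPoint-free x (s≤s z≤n) (s≤s 1≤m)

  succMod²-fixedPoint-free : 2 ≤ m → (x : Fin (suc m)) → succMod (succMod x) ≢ x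
  succMod²-fixedPoint-free 2≤m x s²x≡x =
    rot-fixedPoint-free x (s≤s z≤n) (s≤s 2≤m) (trans (sym (rot-rot 1 1 x)) s²x≡x)

  succMod⁴≡rot4 : (x : Fin (suc m)) → succMod (succMod (succMod (succMod x))) ≡ rot 4 x
  succMod⁴≡rot4 x = trans (cong (λ y → rot 1 (rot 1 y)) (rot-rot 1 1 x))
                          (trans (cong (rot 1) (rot-rot 1 2 x)) (rot-rot 1 3 x))

  rot4-fixedPoint-free : 2 ≤ m → m ≢ 3 → (x : Fin (suc m)) → rot 4 x ≢ x
  rot4-fixedPoint-free 2≤m m≢3 x rot4x≡x with m ≟ 2
  ... | yes refl = succMod-fixedPoint-free (s≤s z≤n) x (begin
        rot 1 x          ≡⟨ cong (rot 1) (rot-full x) ⟨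
        rot 1 (rot 3 x)  ≡⟨ rot-rot 1 3 x ⟩
        rot 4 x          ≡⟨ rot4x≡x ⟩
        x                ∎)
    where open ≡-Reasoning
  ... | no m≢2 = rot-fixedPoint-free x (s≤s z≤n) (s≤s 4≤m) rot4x≡x
    where
      4≤m : 4 ≤ m
      4≤m = ≤∧≢⇒< (≤∧≢⇒< 2≤m (m≢2 ∘ sym)) (m≢3 ∘ sym)

-- The cycle Cₙ

Cycle-sym : Symmetric (Cycle n)
Cycle-sym = swap

Cycle-irrefl : {m : ℕ} → 1 ≤ m → Irreflexive _≡_ (Cycle (suc m))
Cycle-irrefl 1≤m {x} refl (inj₁ x≡sx) = succMod-fixedPoint-free 1≤m x (sym x≡sx)
Cycle-irrefl 1≤m {x} refl (inj₂ x≡sx) = succMod-fixedPoint-free 1≤m x (sym x≡sx)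

-- A closed walk of length 4 either turns back somewhere, making two opposite vertices
-- equal, or takes four steps in one direction, making succMod⁴ fix a vertex.
Cycle-squareFree : {m : ℕ} → 2 ≤ m → m ≢ 3 → SquareFree (Cycle (suc m))
Cycle-squareFree _ _ (inj₁ b≡sa) (inj₂ b≡sc) _ _ a≢c _ = a≢c (succMod-injective (trans (sym b≡sa) b≡sc))
Cycle-squareFree _ _ (inj₂ a≡sb) (inj₁ c≡sb) _ _ a≢c _ = a≢c (trans a≡sb (sym c≡sb))
Cycle-squareFree _ _ _ (inj₁ c≡sb) (inj₂ c≡sd) _ _ b≢d = b≢d (succMod-injective (trans (sym c≡sb) c≡sd))
Cycle-squareFree _ _ _ (inj₂ b≡sc) (inj₁ d≡sc) _ _ b≢d = b≢d (trans b≡sc (sym d≡sc))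
Cycle-squareFree _ _ _ _ (inj₁ d≡sc) (inj₂ d≡sa) a≢c _ = a≢c (succMod-injective (trans (sym d≡sa) d≡sc))
Cycle-squareFree _ _ _ _ (inj₂ c≡sd) (inj₁ a≡sd) a≢c _ = a≢c (trans a≡sd (sym c≡sd))
Cycle-squareFree 2≤m m≢3 {a} (inj₁ b≡sa) (inj₁ c≡sb) (inj₁ d≡sc) (inj₁ a≡sd) _ _ =
  rot4-fixedPoint-free 2≤m m≢3 a (trans (sym (succMod⁴≡rot4 a)) (sym
    (trans a≡sd (cong succMod (trans d≡sc (cong succMod (trans c≡sb (cong succMod b≡sa))))))))
Cycle-squareFree 2≤m m≢3 {a} (inj₂ a≡sb) (inj₂ b≡sc) (inj₂ c≡sd) (inj₂ d≡sa) _ _ =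
  rot4-fixedPoint-free 2≤m m≢3 a (trans (sym (succMod⁴≡rot4 a)) (sym
    (trans a≡sb (cong succMod (trans b≡sc (cong succMod (trans c≡sd (cong succMod d≡sa))))))))

-- Automorphisms of F₂(Cₙ)

inverse : {V : Set} {Adj : V → V → Set} → Automorphism Adj → Automorphism Adj
inverse {Adj = Adj} φ = record
  { f = f⁻¹ ; f⁻¹ = f ; left = right ; right = left
  ; adj = λ x y → mk⇔
      (λ x~y → Equivalence.from (adj (f⁻¹ x) (f⁻¹ y)) (subst₂ Adj (sym (right x)) (sym (right y)) x~y))
      (λ fx~fy → subst₂ Adj (right x) (right y) (Equivalence.to (adj (f⁻¹ x) (f⁻¹ y)) fx~fy))
  }
  where open Automorphism φ

f-injective : {V : Set} {Adj : V → V → Set} (φ : Automorphism Adj) →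
              ∀ {x y} → Automorphism.f φ x ≡ Automorphism.f φ y → x ≡ y
f-injective φ {x} {y} fx≡fy = trans (sym (left x)) (trans (cong f⁻¹ fx≡fy) (left y))
  where open Automorphism φ

module CycleTokens {m : ℕ} (2≤m : 2 ≤ m) (m≢3 : m ≢ 3) where

  private
    V = Fin (suc m)
    Cₙ = Cycle (suc m)
    1≤m = ≤-trans (s≤s z≤n) 2≤m
    Cₙ-irrefl = Cycle-irrefl 1≤m

  open SquareFreeTokens Cycle-sym Cₙ-irrefl (Cycle-squareFree 2≤m m≢3)

  succMod-≢ : (x : V) → x ≢ succMod x
  succMod-≢ x = succMod-fixedPoint-free 1≤m x ∘ sym

  succMod²-≢ : (x : V) → x ≢ succMod (succMod x)
  succMod²-≢ x = succMod²-fixedPoint-free 2≤m x ∘ sym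

  predMod-≢-succMod : (x : V) → predMod x ≢ succMod x
  predMod-≢-succMod x px≡sx = succMod²-≢ x (trans (sym (succMod-predMod x)) (cong succMod px≡sx))

  IsCycleEdge : Pair (suc m) → Set
  IsCycleEdge S = Σ V λ a → IsPair S a (succMod a)

  isCycleEdge⇒isEdgeOf : IsCycleEdge S → IsEdgeOf Cₙ S
  isCycleEdge⇒isEdgeOf (_ , S≐) = isEdgeOf {Γ = Cₙ} Cycle-sym (inj₁ refl) S≐

  edge : V → Pair (suc m)
  edge v = proj₁ (pairOf v (succMod v) (succMod-≢ v))

  edge-isPair : (v : V) → IsPair (edge v) v (succMod v)
  edge-isPair v = proj₂ (pairOf v (succMod v) (succMod-≢ v))

  edge-predMod-isPair : (v : V) → IsPair (edge (predMod v)) (predMod v) v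
  edge-predMod-isPair v =
    subst (IsPair (edge (predMod v)) (predMod v)) (succMod-predMod v) (edge-isPair (predMod v))

  cycleEdge-neighbours : {a : V} → IsPair S a (succMod a) → TokenStep Cₙ S T →
                      IsPair T a (succMod (succMod a)) ⊎ IsPair T (succMod a) (predMod a)
  cycleEdge-neighbours {T = T} {a = a} S≐ st@(tokenStep k _ v S≐k T≐kv _) with isPair-∈ S≐ (∈ˡ S≐k)
  ... | inj₁ refl with tokenStep-moves st S≐ T≐kv
  ...   | inj₁ v≡ssa = inj₁ (subst (IsPair T a) v≡ssa T≐kv)
  ...   | inj₂ sa≡sv = ⊥-elim (distinct T≐kv (succMod-injective sa≡sv))
  cycleEdge-neighbours {T = T} {a = a} S≐ st@(tokenStep k _ v S≐k T≐kv _) | inj₂ refl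
    with tokenStep-moves st (isPair-swap S≐) T≐kv
  ...   | inj₁ v≡sa = ⊥-elim (distinct T≐kv (sym v≡sa))
  ...   | inj₂ a≡sv = inj₂ (subst (IsPair T (succMod a)) v≡pa T≐kv)
    where
      v≡pa : v ≡ predMod a
      v≡pa = trans (sym (predMod-succMod v)) (cong predMod (sym a≡sv))

  record ThreeNeighbours (S : Pair (suc m)) : Set where
    constructor threeNeighbours
    field
      T₁ T₂ T₃       : Pair (suc m)
      step₁          : TokenStep Cₙ S T₁
      step₂          : TokenStep Cₙ S T₂
      step₃          : TokenStep Cₙ S T₃
      T₁≢T₂          : T₁ ≢ T₂
      T₁≢T₃          : T₁ ≢ T₃
      T₂≢T₃          : T₂ ≢ T₃

  cycleEdge-¬threeNeighbours : {a : V} → IsPair S a (succMod a) → ¬ ThreeNeighbours S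
  cycleEdge-¬threeNeighbours {S = S} {a = a} S≐ (threeNeighbours _ _ _ st₁ st₂ st₃ T₁≢T₂ T₁≢T₃ T₂≢T₃) =
    no-three-in-two (classify st₁) (classify st₂) (classify st₃) T₁≢T₂ T₁≢T₃ T₂≢T₃
    where
      forward  = pairOf a (succMod (succMod a)) (succMod²-≢ a)
      backward = pairOf (succMod a) (predMod a) (predMod-≢-succMod a ∘ sym)

      classify : ∀ {T} → TokenStep Cₙ S T → T ≡ proj₁ forward ⊎ T ≡ proj₁ backward
      classify st with cycleEdge-neighbours S≐ st
      ... | inj₁ T≐ = inj₁ (isPair-unique T≐ (proj₂ forward))
      ... | inj₂ T≐ = inj₂ (isPair-unique T≐ (proj₂ backward))

  nonEdge-threeNeighbours : {a b : V} → IsPair S a b → b ≢ succMod a → a ≢ succMod b → ThreeNeighbours S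
  nonEdge-threeNeighbours {a = a} {b = b} S≐ab b≢sa a≢sb =
    threeNeighbours T₁ T₂ T₃
      (tokenStep b a (succMod a) (isPair-swap S≐ab) (isPair-swap T₁≐) (inj₁ refl))
      (tokenStep a b (succMod b) S≐ab T₂≐ (inj₁ refl))
      (tokenStep b a (predMod a) (isPair-swap S≐ab) (isPair-swap T₃≐) (inj₂ (sym (succMod-predMod a))))
      T₁≢T₂ T₁≢T₃ T₂≢T₃
    where
      pa≢b : predMod a ≢ b
      pa≢b pa≡b = a≢sb (trans (sym (succMod-predMod a)) (cong succMod pa≡b))

      T₁ = proj₁ (pairOf (succMod a) b (b≢sa ∘ sym))
      T₁≐ = proj₂ (pairOf (succMod a) b (b≢sa ∘ sym))
      T₂ = proj₁ (pairOf a (succMod b) a≢sb)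
      T₂≐ = proj₂ (pairOf a (succMod b) a≢sb)
      T₃ = proj₁ (pairOf (predMod a) b pa≢b)
      T₃≐ = proj₂ (pairOf (predMod a) b pa≢b)

      T₁≢T₂ : T₁ ≢ T₂
      T₁≢T₂ T₁≡T₂ with isPair-∈ T₂≐ (subst (succMod a ∈ₚ_) T₁≡T₂ (∈ˡ T₁≐))
      ... | inj₁ sa≡a  = succMod-≢ a (sym sa≡a)
      ... | inj₂ sa≡sb = distinct S≐ab (succMod-injective sa≡sb)

      T₁≢T₃ : T₁ ≢ T₃
      T₁≢T₃ T₁≡T₃ with isPair-∈ T₃≐ (subst (succMod a ∈ₚ_) T₁≡T₃ (∈ˡ T₁≐))
      ... | inj₁ sa≡pa = predMod-≢-succMod a (sym sa≡pa)
      ... | inj₂ sa≡b  = b≢sa (sym sa≡b)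

      T₂≢T₃ : T₂ ≢ T₃
      T₂≢T₃ T₂≡T₃ with isPair-∈ T₂≐ (subst (b ∈ₚ_) (sym T₂≡T₃) (∈ʳ T₃≐))
      ... | inj₁ b≡a  = distinct S≐ab (sym b≡a)
      ... | inj₂ b≡sb = succMod-≢ b b≡sb

  isCycleEdge⊎threeNeighbours : (S : Pair (suc m)) → IsCycleEdge S ⊎ ThreeNeighbours S
  isCycleEdge⊎threeNeighbours S@((a , b) , _) with b ≟ᶠ succMod a | a ≟ᶠ succMod b
  ... | yes b≡sa | _        = inj₁ (a , subst (IsPair S a) b≡sa (isPair-ends S))
  ... | no _     | yes a≡sb = inj₁ (b , subst (IsPair S b) a≡sb (isPair-swap (isPair-ends S)))
  ... | no b≢sa  | no a≢sb  = inj₂ (nonEdge-threeNeighbours (isPair-ends S) b≢sa a≢sb)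

  TokenAut : Set
  TokenAut = Automorphism (Token2Adj Cₙ)

  module _ (φ : TokenAut) where
    open Automorphism φ

    tokenStep-preserved : TokenStep Cₙ S T → TokenStep Cₙ (f S) (f T)
    tokenStep-preserved {S} {T} st =
      Token2Adj⇒tokenStep Cycle-sym (Equivalence.to (adj S T) (tokenStep⇒Token2Adj Cₙ-irrefl st))

    threeNeighbours-preserved : ThreeNeighbours S → ThreeNeighbours (f S)
    threeNeighbours-preserved (threeNeighbours T₁ T₂ T₃ st₁ st₂ st₃ T₁≢T₂ T₁≢T₃ T₂≢T₃) =
      threeNeighbours (f T₁) (f T₂) (f T₃)
        (tokenStep-preserved st₁) (tokenStep-preserved st₂) (tokenStep-preserved st₃)
        (T₁≢T₂ ∘ f-injective φ) (T₁≢T₃ ∘ f-injective φ) (T₂≢T₃ ∘ f-injective φ)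

  isCycleEdge-preserved : (φ : TokenAut) {S : Pair (suc m)} → IsCycleEdge S → IsCycleEdge (Automorphism.f φ S)
  isCycleEdge-preserved φ {S} (_ , S≐) with isCycleEdge⊎threeNeighbours (Automorphism.f φ S)
  ... | inj₁ fS-edge = fS-edge
  ... | inj₂ fS-three = ⊥-elim (cycleEdge-¬threeNeighbours S≐
          (subst ThreeNeighbours (Automorphism.left φ S) (threeNeighbours-preserved (inverse φ) fS-three)))

  cycleEdge-∋ : {a w : V} → IsPair Q a (succMod a) → w ∈ₚ Q → Q ≡ edge w ⊎ Q ≡ edge (predMod w)
  cycleEdge-∋ {a = a} Q≐ w∈Q with isPair-∈ Q≐ w∈Q
  ... | inj₁ refl = inj₁ (isPair-unique Q≐ (edge-isPair a))
  ... | inj₂ refl = inj₂ (trans (isPair-unique Q≐ (edge-isPair a)) (cong edge (sym (predMod-succMod a))))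

  ∉-edge-succMod : (v : V) → ¬ v ∈ₚ edge (succMod v)
  ∉-edge-succMod v v∈ with isPair-∈ (edge-isPair (succMod v)) v∈
  ... | inj₁ v≡sv  = succMod-≢ v v≡sv
  ... | inj₂ v≡ssv = succMod²-≢ v v≡ssv

  edge-predMod-≢ : (v : V) → edge (predMod v) ≢ edge v
  edge-predMod-≢ v eq = ∉-edge-succMod (predMod v)
    (subst (predMod v ∈ₚ_) (trans eq (cong edge (sym (succMod-predMod v)))) (∈ˡ (edge-isPair (predMod v))))

  edge-≢-succMod : (v : V) → edge v ≢ edge (succMod v)
  edge-≢-succMod v eq = ∉-edge-succMod v (subst (v ∈ₚ_) eq (∈ˡ (edge-isPair v)))

  edge-predMod-≢-succMod : (v : V) → edge (predMod v) ≢ edge (succMod v)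
  edge-predMod-≢-succMod v eq = ∉-edge-succMod v (subst (v ∈ₚ_) eq (∈ʳ (edge-predMod-isPair v)))

  edge-∩-edge-predMod : {v z : V} → z ∈ₚ edge v → z ∈ₚ edge (predMod v) → z ≡ v
  edge-∩-edge-predMod {v} z∈ z∈′ with isPair-∈ (edge-isPair v) z∈
  ... | inj₁ z≡v  = z≡v
  ... | inj₂ refl with isPair-∈ (edge-predMod-isPair v) z∈′
  ...   | inj₁ sv≡pv = ⊥-elim (predMod-≢-succMod v (sym sv≡pv))
  ...   | inj₂ sv≡v  = ⊥-elim (succMod-≢ v (sym sv≡v))

  module Induced (φ : TokenAut) where
    open Automorphism φ

    f-edge-isCycleEdge : (v : V) → IsCycleEdge (f (edge v))
    f-edge-isCycleEdge v = isCycleEdge-preserved φ (v , edge-isPair v)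

    f-edge-∋ : {w : V} (v : V) → w ∈ₚ f (edge v) → f (edge v) ≡ edge w ⊎ f (edge v) ≡ edge (predMod w)
    f-edge-∋ v = cycleEdge-∋ (proj₂ (f-edge-isCycleEdge v))

    θ : V → V
    θ v = common (f (edge v)) (f (edge (predMod v)))

    θ-∈ : (v : V) → θ v ∈ₚ f (edge v) × θ v ∈ₚ f (edge (predMod v))
    θ-∈ v = common-∈ {S = f (edge v)} {T = f (edge (predMod v))}
      (edgePairs-meet (isCycleEdge⇒isEdgeOf (f-edge-isCycleEdge v))
                      (isCycleEdge⇒isEdgeOf (f-edge-isCycleEdge (predMod v)))
                      (tokenStep-preserved φ toEdge) (tokenStep-preserved φ toEdgePred))
      where
        around = pairOf (predMod v) (succMod v) (predMod-≢-succMod v)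

        toEdge : TokenStep Cₙ (proj₁ around) (edge v)
        toEdge = tokenStep (succMod v) (predMod v) v (isPair-swap (proj₂ around))
                   (isPair-swap (edge-isPair v)) (inj₁ (sym (succMod-predMod v)))

        toEdgePred : TokenStep Cₙ (proj₁ around) (edge (predMod v))
        toEdgePred = tokenStep (predMod v) (succMod v) v (proj₂ around) (edge-predMod-isPair v) (inj₂ refl)

    θ-succMod-∈ : (v : V) → θ (succMod v) ∈ₚ f (edge v)
    θ-succMod-∈ v = subst (λ u → θ (succMod v) ∈ₚ f (edge u)) (predMod-succMod v) (proj₂ (θ-∈ (succMod v)))

    θ-≢-succMod : (v : V) → θ v ≢ θ (succMod v)
    θ-≢-succMod v θv≡θsv =
      no-three-in-two (f-edge-∋ (predMod v) (proj₂ (θ-∈ v)))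
                      (f-edge-∋ v (proj₁ (θ-∈ v)))
                      (f-edge-∋ (succMod v) (subst (_∈ₚ f (edge (succMod v))) (sym θv≡θsv) (proj₁ (θ-∈ (succMod v)))))
                      (edge-predMod-≢ v ∘ f-injective φ)
                      (edge-predMod-≢-succMod v ∘ f-injective φ)
                      (edge-≢-succMod v ∘ f-injective φ)

    θ-isPair : (v : V) → IsPair (f (edge v)) (θ v) (θ (succMod v))
    θ-isPair v = isPair (proj₁ (θ-∈ v)) (θ-succMod-∈ v) (θ-≢-succMod v)

    θ-adj-succMod : (v : V) → Cₙ (θ v) (θ (succMod v))
    θ-adj-succMod v = isCycleEdge⇒isEdgeOf (f-edge-isCycleEdge v) (θ-isPair v)

    θ-hom : {x y : V} → Cₙ x y → Cₙ (θ x) (θ y)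
    θ-hom {x} (inj₁ refl) = θ-adj-succMod x
    θ-hom {y = y} (inj₂ refl) = Cycle-sym (θ-adj-succMod y)

  θ-inverse : (φ : TokenAut) (v : V) → Induced.θ (inverse φ) (Induced.θ φ v) ≡ v
  θ-inverse φ v = uncurry edge-∩-edge-predMod
                    (sorted (f-edge-∋ v (proj₁ (θ-∈ v))) (f-edge-∋ (predMod v) (proj₂ (θ-∈ v))))
    where
      open Automorphism φ
      open Induced φ
      θv = θ v
      θ′θv = Induced.θ (inverse φ) θv

      θ′θv∈ : θ′θv ∈ₚ f⁻¹ (edge θv) × θ′θv ∈ₚ f⁻¹ (edge (predMod θv))
      θ′θv∈ = Induced.θ-∈ (inverse φ) θv

      pull : ∀ {X Y} → f X ≡ Y → θ′θv ∈ₚ f⁻¹ Y → θ′θv ∈ₚ X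
      pull {X} fX≡Y = subst (θ′θv ∈ₚ_) (trans (cong f⁻¹ (sym fX≡Y)) (left X))

      sorted : f (edge v) ≡ edge θv ⊎ f (edge v) ≡ edge (predMod θv) →
               f (edge (predMod v)) ≡ edge θv ⊎ f (edge (predMod v)) ≡ edge (predMod θv) →
               θ′θv ∈ₚ edge v × θ′θv ∈ₚ edge (predMod v)
      sorted (inj₁ fA≡) (inj₂ fB≡) = pull fA≡ (proj₁ θ′θv∈) , pull fB≡ (proj₂ θ′θv∈)
      sorted (inj₂ fA≡) (inj₁ fB≡) = pull fA≡ (proj₂ θ′θv∈) , pull fB≡ (proj₁ θ′θv∈)
      sorted (inj₁ fA≡) (inj₁ fB≡) = ⊥-elim (edge-predMod-≢ v (f-injective φ (trans fB≡ (sym fA≡))))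
      sorted (inj₂ fA≡) (inj₂ fB≡) = ⊥-elim (edge-predMod-≢ v (f-injective φ (trans fB≡ (sym fA≡))))

  inducedAutomorphism : TokenAut → Automorphism Cₙ
  inducedAutomorphism φ = record
    { f     = Induced.θ φ
    ; f⁻¹   = Induced.θ (inverse φ)
    ; left  = θ-inverse φ
    ; right = θ-inverse (inverse φ)
    ; adj   = λ x y → mk⇔ (Induced.θ-hom φ) λ θx~θy →
        subst₂ Cₙ (θ-inverse φ x) (θ-inverse φ y) (Induced.θ-hom (inverse φ) θx~θy)
    }

  module _ (φ : TokenAut) where
    open Automorphism φ
    open Induced φ

    θ-injective : {x y : V} → θ x ≡ θ y → x ≡ y
    θ-injective = f-injective (inducedAutomorphism φ)

    InducedAtDistance : ℕ → Set
    InducedAtDistance k = ∀ i {S} → IsPair S i (rot k i) → IsPair (f S) (θ i) (θ (rot k i))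

    inducedAtDistance-1 : InducedAtDistance 1
    inducedAtDistance-1 i S≐ = subst (λ S → IsPair (f S) (θ i) (θ (succMod i)))
                                     (isPair-unique (edge-isPair i) S≐) (θ-isPair i)

    θ-rot-≢ : ∀ {j k} (i : V) → j < k → k < suc m → θ (rot j i) ≢ θ (rot k i)
    θ-rot-≢ i j<k k<n = rot-injectiveʳ i j<k k<n ∘ θ-injective

    θ-≢-rot : ∀ {k} (i : V) → 0 < k → k < suc m → θ i ≢ θ (rot k i)
    θ-≢-rot i 0<k k<n = rot-fixedPoint-free i 0<k k<n ∘ sym ∘ θ-injective

    inducedAtDistance-2 : InducedAtDistance 2
    inducedAtDistance-2 i {S} S≐ =
      subst (λ j → IsPair (f S) (θ i) (θ j)) (rot-rot 1 1 i)
        (commonNeighbour-path (θ-adj-succMod i) (θ-adj-succMod (succMod i))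
          (succMod²-≢ i ∘ θ-injective)
          (θ-isPair i) (θ-isPair (succMod i))
          (tokenStep-preserved φ toEdge) (tokenStep-preserved φ toNextEdge))
      where
        S≐′ : IsPair S i (succMod (succMod i))
        S≐′ = subst (IsPair S i) (sym (rot-rot 1 1 i)) S≐

        toEdge : TokenStep Cₙ S (edge i)
        toEdge = tokenStep i _ (succMod i) S≐′ (edge-isPair i) (inj₂ refl)

        toNextEdge : TokenStep Cₙ S (edge (succMod i))
        toNextEdge = tokenStep _ i (succMod i) (isPair-swap S≐′)
                       (isPair-swap (edge-isPair (succMod i))) (inj₁ refl)

    inducedAtDistance-step : ∀ {k} → 1 ≤ k → suc (suc k) < suc m →
                             InducedAtDistance k → InducedAtDistance (suc k) → InducedAtDistance (suc (suc k))
    inducedAtDistance-step {k} 1≤k k+2<n induced-k induced-k+1 i {S} S≐ =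
      commonNeighbour-ladder (θ-adj-succMod i) far-adj (θ-≢-rot i (s≤s z≤n) k+2<n) (θ-rot-≢ i 1<k+1 k+1<n ∘ sym)
        (induced-k+1 i lower≐) upper-image
        (tokenStep-preserved φ toLower) (tokenStep-preserved φ toUpper) fS≢f-inner
      where
        k+1<n : suc k < suc m
        k+1<n = <-trans (n<1+n (suc k)) k+2<n
        1<k+1 : 1 < suc k
        1<k+1 = s≤s 1≤k

        lower = pairOf i (rot (suc k) i) (rot-fixedPoint-free i (s≤s z≤n) k+1<n ∘ sym)
        upper = pairOf (succMod i) (rot (suc (suc k)) i) (rot-injectiveʳ i (s≤s (s≤s z≤n)) k+2<n)
        inner = pairOf (succMod i) (rot (suc k) i) (rot-injectiveʳ i 1<k+1 k+1<n)
        lower≐ = proj₂ lower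
        upper≐ = proj₂ upper
        inner≐ = proj₂ inner

        far-adj : Cₙ (θ (rot (suc k) i)) (θ (rot (suc (suc k)) i))
        far-adj = subst (Cₙ (θ (rot (suc k) i)) ∘ θ) (succMod-rot (suc k) i) (θ-adj-succMod (rot (suc k) i))

        upper-image : IsPair (f (proj₁ upper)) (θ (succMod i)) (θ (rot (suc (suc k)) i))
        upper-image = subst (λ j → IsPair (f (proj₁ upper)) (θ (succMod i)) (θ j)) (rot-succMod (suc k) i)
          (induced-k+1 (succMod i) (subst (IsPair (proj₁ upper) (succMod i)) (sym (rot-succMod (suc k) i)) upper≐))

        inner-image : IsPair (f (proj₁ inner)) (θ (succMod i)) (θ (rot (suc k) i))
        inner-image = subst (λ j → IsPair (f (proj₁ inner)) (θ (succMod i)) (θ j)) (rot-succMod k i)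
          (induced-k (succMod i) (subst (IsPair (proj₁ inner) (succMod i)) (sym (rot-succMod k i)) inner≐))

        toLower : TokenStep Cₙ S (proj₁ lower)
        toLower = tokenStep i (rot (suc (suc k)) i) (rot (suc k) i) S≐ lower≐ (inj₂ (sym (succMod-rot (suc k) i)))

        toUpper : TokenStep Cₙ S (proj₁ upper)
        toUpper = tokenStep (rot (suc (suc k)) i) i (succMod i) (isPair-swap S≐) (isPair-swap upper≐) (inj₁ refl)

        fS≢f-inner : ¬ IsPair (f S) (θ (rot (suc k) i)) (θ (succMod i))
        fS≢f-inner fS≐ = [ succMod-≢ i ∘ sym , rot-injectiveʳ i (s≤s (s≤s z≤n)) k+2<n ]′ (isPair-∈ S≐ si∈S)
          where
            S≡inner = f-injective φ (isPair-unique (isPair-swap fS≐) inner-image)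
            si∈S = subst (succMod i ∈ₚ_) (sym S≡inner) (∈ˡ inner≐)

    inducedAtDistance-consecutive : ∀ j → suc (suc j) < suc m →
                                    InducedAtDistance (suc j) × InducedAtDistance (suc (suc j))
    inducedAtDistance-consecutive zero    _      = inducedAtDistance-1 , inducedAtDistance-2
    inducedAtDistance-consecutive (suc j) j+3<n =
      induced-j+2 , inducedAtDistance-step (s≤s z≤n) j+3<n induced-j+1 induced-j+2
      where
        induced-j+1,j+2 = inducedAtDistance-consecutive j (<-trans (n<1+n (suc (suc j))) j+3<n)
        induced-j+1 = proj₁ induced-j+1,j+2
        induced-j+2 = proj₂ induced-j+1,j+2

    inducedAtDistance : ∀ k → 0 < k → k < suc m → InducedAtDistance k
    inducedAtDistance (suc zero)    _ _   = inducedAtDistance-1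
    inducedAtDistance (suc (suc j)) _ k<n = proj₂ (inducedAtDistance-consecutive j k<n)

    f-isPair : {a b : V} → toℕ a < toℕ b → IsPair S a b → IsPair (f S) (θ a) (θ b)
    f-isPair {S = S} {a} {b} a<b S≐ =
      subst (λ c → IsPair (f S) (θ a) (θ c)) (rot-between a<b)
        (inducedAtDistance k (m<n⇒0<n∸m a<b) (≤-<-trans (m∸n≤m (toℕ b) (toℕ a)) (toℕ<n b)) a
          (subst (IsPair S a) (sym (rot-between a<b)) S≐))
      where k = toℕ b ∸ toℕ a

    θ-induces : InducedBy θ f
    θ-induces = isPair⇒inducedBy λ { S@(_ , a<b) → f-isPair a<b (isPair-ends S) }

mainTheorem7 : (n : ℕ) → 3 ≤ n → n ≢ 4 →
    (φ : Automorphism (Token2Adj (Cycle n))) →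
    Σ (Automorphism (Cycle n)) λ θ →
      InducedBy (Automorphism.f θ) (Automorphism.f φ)
mainTheorem7 (suc (suc (suc k))) _ n≢4 φ = inducedAutomorphism φ , θ-induces φ
  where open CycleTokens {suc (suc k)} (s≤s (s≤s z≤n)) (n≢4 ∘ cong suc)
mainTheorem7 (suc zero)       (s≤s ())       _ _
mainTheorem7 (suc (suc zero)) (s≤s (s≤s ())) _ _
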